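{- Let $f, g$ be numerical polynomials, or more generally $f, g \in \mathbf{QP}_{\gg 0}$. Define $d(n) = \gcd(f(n), g(n))$. Then $d \in \mathbf{QP}_{\gg 0}$.
   Context: A numerical polynomial is a function $f\colon \mathbf{Z}\to\mathbf{Z}$ agreeing at all integers with some polynomial in $\mathbf{Q}[x]$. A function $f$ with integer values defined on all sufficiently large integers is eventually a quasi-polynomial if there exist a positive integer $s$ and polynomials $f_0,\dots,f_{s-1} \in \mathbf{Q}[t]$ such that $f(n) = f_i(n)$ for all sufficiently large $n$ with $n \equiv i \pmod s$; $\mathbf{QP}_{\gg 0}$ denotes the set (a ring under pointwise operations) of such functions. The function $d$ is called the generalized gcd of $f$ and $g$, written $\operatorname{ggcd}(f,g)$. -}

module Defs where

open import Data.Nat using (ℕ; suc; _≤_)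
open import Data.Nat.DivMod using (_mod_)
open import Data.Fin using (Fin)
open import Data.Integer using (ℤ)
import Data.Integer as ℤ
open import Data.Integer.GCD using (gcd)
open import Data.Rational using (ℚ; _+_; _*_; 0ℚ; _/_)
open import Data.List using (List; []; _∷_)
open import Data.Product using (Σ)
open import Relation.Binary.PropositionalEquality using (_≡_)

-- A polynomial in ℚ[t], as its list of coefficients (constant term first).
Poly : Set
Poly = List ℚ

eval : Poly → ℚ → ℚ
eval []       t = 0ℚ
eval (a ∷ as) t = a + t * eval as t

toℚ : ℤ → ℚ
toℚ i = i / 1

-- Integer-valued functions on (sufficiently large) integers; only large
-- arguments matter, so we take the domain to be ℕ.
-- f ∈ QP≫0 : there are a period s = suc k ≥ 1, polynomials f₀ … f_{s-1} ∈ ℚ[t]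
-- and a threshold N with f(n) = f_{n mod s}(n) for all n ≥ N.
IsEventuallyQP : (ℕ → ℤ) → Set
IsEventuallyQP f =
  Σ ℕ λ k → Σ (Fin (suc k) → Poly) λ fs → Σ ℕ λ N →
    ∀ n → N ≤ n → toℚ (f n) ≡ eval (fs (n mod suc k)) (toℚ (ℤ.+ n))

-- the generalized gcd, pointwise (nonnegative gcd, gcd 0 0 = 0)
ggcd : (ℕ → ℤ) → (ℕ → ℤ) → (ℕ → ℤ)
ggcd f g n = gcd (f n) (g n)

module Submission where

-- On a residue class modulo the product of the two periods, f and g are
-- given by fixed polynomials F, G ∈ ℚ[t], so everything reduces to the
-- gcd of the values F(n), G(n).  The Euclidean algorithm in ℚ[t] gives
-- F = h·F₁, G = h·G₁ with A·F₁ + B·G₁ = 1; clearing denominators turns this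
-- into integer polynomials with c·F = H·P, c·G = H·Q and A·P + B·Q = c.
-- Then c·gcd(F(n), G(n)) = |H(n)|·gcd(P(n), Q(n)), where gcd(P(n), Q(n))
-- is periodic in n with period c (it divides c, and P, Q respect
-- congruences mod c) and |H(n)| = σ·H(n) for large n (polynomial values
-- have eventually constant sign).  So on each class the gcd is a
-- quasi-polynomial, and finitely many quasi-polynomials on the residue
-- classes glue to one with the product of all the periods as period.

open import Defs
open import Function using (_∘_; _∘′_)
open import Data.Product using (Σ; _,_; _×_; proj₁; proj₂)
open import Data.Sum using (_⊎_; inj₁; inj₂)
open import Relation.Binary.PropositionalEquality
open import Relation.Nullary using (¬_; yes; no)

open import Data.Nat as ℕ using (ℕ; zero; suc; z≤n; s≤s)
import Data.Nat.Properties as ℕP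
import Data.Nat.Divisibility as ℕD
import Data.Nat.GCD as ℕG
open import Data.Nat.DivMod using (_mod_; m%n<n; m%n%n≡m%n; m≡m%n+[m/n]*n; m∣n⇒o%n%m≡o%m)
open import Data.Nat.ListAction using (product)
open import Data.Nat.ListAction.Properties using (∈⇒∣product; product≢0)
open import Data.Fin using (toℕ)
import Data.Fin.Properties as FinP

open import Data.Integer as ℤ using (ℤ; +_; -[1+_]; +[1+_]; ∣_∣; 0ℤ; -1ℤ)
import Data.Integer.Properties as ℤP
open import Data.Integer.GCD using (gcd)
open import Data.Integer.Divisibility.Signed using (divides; ∣ᵤ⇒∣; ∣⇒∣ᵤ; ∣m∣n⇒∣m+n; ∣n⇒∣m*n; ∣-trans; ∣-refl)
  renaming (_∣_ to _∣ℤ_)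
import Data.Integer.Solver

open import Data.Rational as ℚ using (ℚ; _+_; _*_; _-_; -_; 0ℚ; 1ℚ; _÷_; ↥_; ↧ₙ_)
import Data.Rational.Properties as ℚP
import Data.Rational.Unnormalised as ℚᵘ
import Data.Rational.Unnormalised.Properties as ℚᵘP
import Data.Rational.Solver

open import Data.List using (List; []; _∷_; _++_; length; map; upTo)
open import Data.List.Extrema.Nat using (max; xs≤max)
open import Data.List.Membership.Propositional using (_∈_)
open import Data.List.Membership.Propositional.Properties using (∈-map⁺; ∈-++⁺ˡ; ∈-++⁺ʳ; ∈-upTo⁺)
open import Data.List.Relation.Unary.Any using (here; there)
import Data.List.Relation.Unary.All as All
import Data.List.Relation.Unary.All.Properties as AllP

module ℚ-Solver = Data.Rational.Solver.+-*-Solver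
module ℤ-Solver = Data.Integer.Solver.+-*-Solver

-- The embedding toℚ : ℤ → ℚ is an injective ring homomorphism.  This is
-- seen through unnormalised rationals, where i ↦ i/1 is visibly
-- compatible with + and *; ι is that unnormalised image.

ι : ℤ → ℚᵘ.ℚᵘ
ι i = ℚᵘ.mkℚᵘ i 0

toℚᵘ-toℚ : ∀ i → ℚ.toℚᵘ (toℚ i) ℚᵘ.≃ ι i
toℚᵘ-toℚ i = ℚP.toℚᵘ-fromℚᵘ (ι i)

toℚ-+ : ∀ a b → toℚ (a ℤ.+ b) ≡ toℚ a + toℚ b
toℚ-+ a b = ℚP.toℚᵘ-injective (begin
    ℚ.toℚᵘ (toℚ (a ℤ.+ b))                 ≈⟨ toℚᵘ-toℚ (a ℤ.+ b) ⟩
    ι (a ℤ.+ b)                             ≈⟨ ℚᵘ.*≡* (cong₂ ℤ._*_ (cong₂ ℤ._+_ (sym (ℤP.*-identityʳ a)) (sym (ℤP.*-identityʳ b))) refl) ⟩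
    ι a ℚᵘ.+ ι b                            ≈⟨ ℚᵘP.+-cong (toℚᵘ-toℚ a) (toℚᵘ-toℚ b) ⟨
    ℚ.toℚᵘ (toℚ a) ℚᵘ.+ ℚ.toℚᵘ (toℚ b)      ≈⟨ ℚP.toℚᵘ-homo-+ (toℚ a) (toℚ b) ⟨
    ℚ.toℚᵘ (toℚ a + toℚ b)                  ∎)
  where open ℚᵘP.≃-Reasoning

toℚ-* : ∀ a b → toℚ (a ℤ.* b) ≡ toℚ a * toℚ b
toℚ-* a b = ℚP.toℚᵘ-injective (begin
    ℚ.toℚᵘ (toℚ (a ℤ.* b))                 ≈⟨ toℚᵘ-toℚ (a ℤ.* b) ⟩
    ι (a ℤ.* b)                             ≈⟨ ℚᵘ.*≡* refl ⟩
    ι a ℚᵘ.* ι b                            ≈⟨ ℚᵘP.*-cong (toℚᵘ-toℚ a) (toℚᵘ-toℚ b) ⟨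
    ℚ.toℚᵘ (toℚ a) ℚᵘ.* ℚ.toℚᵘ (toℚ b)      ≈⟨ ℚP.toℚᵘ-homo-* (toℚ a) (toℚ b) ⟨
    ℚ.toℚᵘ (toℚ a * toℚ b)                  ∎)
  where open ℚᵘP.≃-Reasoning

toℚ-injective : ∀ {a b} → toℚ a ≡ toℚ b → a ≡ b
toℚ-injective {a} {b} eq with ℚᵘP.≃-trans (ℚᵘP.≃-sym (toℚᵘ-toℚ a)) (ℚᵘP.≃-trans (ℚP.toℚᵘ-cong eq) (toℚᵘ-toℚ b))
... | ℚᵘ.*≡* e = trans (sym (ℤP.*-identityʳ a)) (trans e (ℤP.*-identityʳ b))

toℚ-ℕ* : ∀ m n → toℚ (+ (m ℕ.* n)) ≡ toℚ (+ m) * toℚ (+ n)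
toℚ-ℕ* m n = trans (cong toℚ (ℤP.pos-* m n)) (toℚ-* (+ m) (+ n))

toℚ-nonZero : ∀ c .{{_ : ℕ.NonZero c}} → ℚ.NonZero (toℚ (+ c))
toℚ-nonZero (suc c) = ℚ.≢-nonZero λ eq → ℕP.1+n≢0 {c} (ℤP.+-injective (toℚ-injective {+ suc c} {+ 0} eq))

_^_ : ℚ → ℕ → ℚ
t ^ zero  = 1ℚ
t ^ suc k = t * t ^ k

^-+ : ∀ t k m → t ^ (k ℕ.+ m) ≡ t ^ k * t ^ m
^-+ t zero    m = sym (ℚP.*-identityˡ _)
^-+ t (suc k) m = trans (cong (t *_) (^-+ t k m)) (sym (ℚP.*-assoc t _ _))

_⊕_ : Poly → Poly → Poly
[]      ⊕ Q       = Q
(a ∷ P) ⊕ []      = a ∷ P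
(a ∷ P) ⊕ (b ∷ Q) = (a + b) ∷ (P ⊕ Q)

scale : ℚ → Poly → Poly
scale c = map (c *_)

_⊖_ : Poly → Poly → Poly
P ⊖ Q = P ⊕ scale (- 1ℚ) Q

shift : ℕ → Poly → Poly
shift zero    P = P
shift (suc k) P = 0ℚ ∷ shift k P

_⊗_ : Poly → Poly → Poly
[]      ⊗ Q = []
(a ∷ P) ⊗ Q = scale a Q ⊕ (0ℚ ∷ (P ⊗ Q))

const : ℚ → Poly
const c = c ∷ []

infixl 6 _⊕_ _⊖_
infixl 7 _⊗_

eval-⊕ : ∀ P Q t → eval (P ⊕ Q) t ≡ eval P t + eval Q t
eval-⊕ []      Q       t = sym (ℚP.+-identityˡ _)
eval-⊕ (a ∷ P) []      t = sym (ℚP.+-identityʳ _)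
eval-⊕ (a ∷ P) (b ∷ Q) t = begin
  (a + b) + t * eval (P ⊕ Q) t          ≡⟨ cong (λ u → (a + b) + t * u) (eval-⊕ P Q t) ⟩
  (a + b) + t * (eval P t + eval Q t)   ≡⟨ solve 5 (λ a b t x y → (a :+ b) :+ t :* (x :+ y) := (a :+ t :* x) :+ (b :+ t :* y)) refl a b t (eval P t) (eval Q t) ⟩
  (a + t * eval P t) + (b + t * eval Q t) ∎
  where open ≡-Reasoning; open ℚ-Solver

eval-scale : ∀ c P t → eval (scale c P) t ≡ c * eval P t
eval-scale c []      t = sym (ℚP.*-zeroʳ c)
eval-scale c (a ∷ P) t = begin
  c * a + t * eval (scale c P) t  ≡⟨ cong (λ u → c * a + t * u) (eval-scale c P t) ⟩
  c * a + t * (c * eval P t)      ≡⟨ solve 4 (λ c a t x → c :* a :+ t :* (c :* x) := c :* (a :+ t :* x)) refl c a t (eval P t) ⟩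
  c * (a + t * eval P t)          ∎
  where open ≡-Reasoning; open ℚ-Solver

eval-⊖ : ∀ P Q t → eval (P ⊖ Q) t ≡ eval P t - eval Q t
eval-⊖ P Q t = begin
  eval (P ⊖ Q) t                       ≡⟨ eval-⊕ P (scale (- 1ℚ) Q) t ⟩
  eval P t + eval (scale (- 1ℚ) Q) t   ≡⟨ cong (λ u → eval P t + u) (eval-scale (- 1ℚ) Q t) ⟩
  eval P t + - 1ℚ * eval Q t           ≡⟨ solve 2 (λ p q → p :+ :- con 1ℚ :* q := p :- q) refl (eval P t) (eval Q t) ⟩
  eval P t - eval Q t                  ∎
  where open ≡-Reasoning; open ℚ-Solver

eval-shift : ∀ k P t → eval (shift k P) t ≡ t ^ k * eval P t
eval-shift zero    P t = sym (ℚP.*-identityˡ _)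
eval-shift (suc k) P t = begin
  0ℚ + t * eval (shift k P) t  ≡⟨ cong (λ u → 0ℚ + t * u) (eval-shift k P t) ⟩
  0ℚ + t * (t ^ k * eval P t)  ≡⟨ solve 3 (λ t p x → con 0ℚ :+ t :* (p :* x) := (t :* p) :* x) refl t (t ^ k) (eval P t) ⟩
  t * t ^ k * eval P t         ∎
  where open ≡-Reasoning; open ℚ-Solver

eval-⊗ : ∀ P Q t → eval (P ⊗ Q) t ≡ eval P t * eval Q t
eval-⊗ []      Q t = sym (ℚP.*-zeroˡ (eval Q t))
eval-⊗ (a ∷ P) Q t = begin
  eval (scale a Q ⊕ (0ℚ ∷ P ⊗ Q)) t                 ≡⟨ eval-⊕ (scale a Q) (0ℚ ∷ P ⊗ Q) t ⟩
  eval (scale a Q) t + (0ℚ + t * eval (P ⊗ Q) t)    ≡⟨ cong₂ (λ u v → u + (0ℚ + t * v)) (eval-scale a Q t) (eval-⊗ P Q t) ⟩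
  a * eval Q t + (0ℚ + t * (eval P t * eval Q t))   ≡⟨ solve 4 (λ a t x y → a :* y :+ (con 0ℚ :+ t :* (x :* y)) := (a :+ t :* x) :* y) refl a t (eval P t) (eval Q t) ⟩
  (a + t * eval P t) * eval Q t                     ∎
  where open ≡-Reasoning; open ℚ-Solver

eval-const : ∀ c t → eval (const c) t ≡ c
eval-const c t = solve 2 (λ c t → c :+ t :* con 0ℚ := c) refl c t
  where open ℚ-Solver

-- Length bounds, the termination measure of the Euclidean algorithm.
length-⊕ : ∀ P Q {n} → length P ℕ.≤ n → length Q ℕ.≤ n → length (P ⊕ Q) ℕ.≤ n
length-⊕ []      Q       p       q       = q
length-⊕ (a ∷ P) []      p       q       = p
length-⊕ (a ∷ P) (b ∷ Q) (s≤s p) (s≤s q) = s≤s (length-⊕ P Q p q)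

length-scale : ∀ c P → length (scale c P) ≡ length P
length-scale c []      = refl
length-scale c (a ∷ P) = cong suc (length-scale c P)

length-shift : ∀ k P → length (shift k P) ≡ k ℕ.+ length P
length-shift zero    P = refl
length-shift (suc k) P = cong suc (length-shift k P)

-- Every polynomial either vanishes identically or splits off its leading
-- term: P = Ps + t^|Ps| · a with a ≠ 0 and Ps strictly shorter than P.
-- Degree is measured by list length, so trailing zeros are harmless.
data LeadingTerm (P : Poly) : Set where
  vanishing : (∀ t → eval P t ≡ 0ℚ) → LeadingTerm P
  leading   : (Ps : Poly) (a : ℚ) → ¬ (a ≡ 0ℚ) →
              (∀ t → eval P t ≡ eval Ps t + t ^ length Ps * a) →
              length Ps ℕ.< length P → LeadingTerm P

leadingTerm : ∀ P → LeadingTerm P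
leadingTerm []      = vanishing (λ t → refl)
leadingTerm (x ∷ P) with leadingTerm P
... | leading Ps a a≢0 eq lt = leading (x ∷ Ps) a a≢0 eq′ (s≤s lt)
  where
  eq′ : ∀ t → eval (x ∷ P) t ≡ eval (x ∷ Ps) t + t ^ length (x ∷ Ps) * a
  eq′ t = begin
    x + t * eval P t                        ≡⟨ cong (λ u → x + t * u) (eq t) ⟩
    x + t * (eval Ps t + t ^ length Ps * a) ≡⟨ solve 5 (λ x t y p a → x :+ t :* (y :+ p :* a) := (x :+ t :* y) :+ (t :* p) :* a) refl x t (eval Ps t) (t ^ length Ps) a ⟩
    (x + t * eval Ps t) + t * t ^ length Ps * a ∎
    where open ≡-Reasoning; open ℚ-Solver
... | vanishing z with x ℚP.≟ 0ℚ
...   | yes refl = vanishing λ t → trans (cong (λ u → 0ℚ + t * u) (z t)) (solve 1 (λ t → con 0ℚ :+ t :* con 0ℚ := con 0ℚ) refl t)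
  where open ℚ-Solver
...   | no x≢0   = leading [] x x≢0 (λ t → trans (cong (λ u → x + t * u) (z t)) (solve 2 (λ x t → x :+ t :* con 0ℚ := con 0ℚ :+ con 1ℚ :* x) refl x t)) (s≤s z≤n)
  where open ℚ-Solver

record DivisionStep (F G : Poly) (n : ℕ) : Set where
  field
    M R   : Poly
    split : ∀ t → eval F t ≡ eval M t * eval G t + eval R t
    short : length R ℕ.≤ n

cancelLeadingTerm : ∀ F G Fs Gs a b → ¬ (b ≡ 0ℚ) →
  (∀ t → eval F t ≡ eval Fs t + t ^ length Fs * a) →
  (∀ t → eval G t ≡ eval Gs t + t ^ length Gs * b) →
  length Gs ℕ.≤ length Fs → DivisionStep F G (length Fs)
cancelLeadingTerm F G Fs Gs a b b≢0 eqF eqG Gs≤Fs = record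
  { M = shift k (const c) ; R = R ; split = split ; short = short }
  where
  instance _ = ℚ.≢-nonZero b≢0
  c : ℚ
  c = a ÷ b
  k : ℕ
  k = length Fs ℕ.∸ length Gs
  R : Poly
  R = Fs ⊖ scale c (shift k Gs)

  k+|Gs| : k ℕ.+ length Gs ≡ length Fs
  k+|Gs| = ℕP.m∸n+n≡m Gs≤Fs

  c*b : c * b ≡ a
  c*b = trans (ℚP.*-assoc a (ℚ.1/ b) b) (trans (cong (a *_) (ℚP.*-inverseˡ b)) (ℚP.*-identityʳ a))

  short : length R ℕ.≤ length Fs
  short = length-⊕ Fs _ ℕP.≤-refl (ℕP.≤-reflexive (begin
    length (scale (- 1ℚ) (scale c (shift k Gs))) ≡⟨ length-scale (- 1ℚ) (scale c (shift k Gs)) ⟩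
    length (scale c (shift k Gs))                ≡⟨ length-scale c (shift k Gs) ⟩
    length (shift k Gs)                          ≡⟨ length-shift k Gs ⟩
    k ℕ.+ length Gs                              ≡⟨ k+|Gs| ⟩
    length Fs                                    ∎))
    where open ≡-Reasoning

  split : ∀ t → eval F t ≡ eval (shift k (const c)) t * eval G t + eval R t
  split t = begin
    eval F t                                               ≡⟨ eqF t ⟩
    eval Fs t + t ^ length Fs * a                          ≡⟨ cong₂ (λ u v → eval Fs t + u * v) (trans (cong (t ^_) (sym k+|Gs|)) (^-+ t k (length Gs))) (sym c*b) ⟩
    eval Fs t + (t ^ k * t ^ length Gs) * (c * b)          ≡⟨ solve 6 (λ f p q c b g → f :+ (p :* q) :* (c :* b) := p :* c :* (g :+ q :* b) :+ (f :- c :* (p :* g))) refl (eval Fs t) (t ^ k) (t ^ length Gs) c b (eval Gs t) ⟩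
    t ^ k * c * (eval Gs t + t ^ length Gs * b) + (eval Fs t - c * (t ^ k * eval Gs t))
      ≡⟨ cong₂ (λ u v → u * v + (eval Fs t - c * (t ^ k * eval Gs t))) (sym Mt) (sym (eqG t)) ⟩
    eval (shift k (const c)) t * eval G t + (eval Fs t - c * (t ^ k * eval Gs t))
      ≡⟨ cong (λ u → eval (shift k (const c)) t * eval G t + u) (sym Rt) ⟩
    eval (shift k (const c)) t * eval G t + eval R t       ∎
    where
    open ≡-Reasoning; open ℚ-Solver
    Mt : eval (shift k (const c)) t ≡ t ^ k * c
    Mt = trans (eval-shift k (const c) t) (cong (t ^ k *_) (eval-const c t))
    Rt : eval R t ≡ eval Fs t - c * (t ^ k * eval Gs t)
    Rt = trans (eval-⊖ Fs (scale c (shift k Gs)) t) (cong (λ u → eval Fs t - u) (trans (eval-scale c (shift k Gs) t) (cong (c *_) (eval-shift k Gs t))))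

record Bezout (F G : Poly) : Set where
  field
    h A B F₁ G₁ : Poly
    factorF     : ∀ t → eval F t ≡ eval h t * eval F₁ t
    factorG     : ∀ t → eval G t ≡ eval h t * eval G₁ t
    identity    : ∀ t → eval A t * eval F₁ t + eval B t * eval G₁ t ≡ 1ℚ

bezout-swap : ∀ {F G} → Bezout F G → Bezout G F
bezout-swap c = record
  { h = h ; A = B ; B = A ; F₁ = G₁ ; G₁ = F₁ ; factorF = factorG ; factorG = factorF
  ; identity = λ t → trans (ℚP.+-comm (eval B t * eval G₁ t) (eval A t * eval F₁ t)) (identity t) }
  where open Bezout c

bezout-zero : ∀ F G → (∀ t → eval G t ≡ 0ℚ) → Bezout F G
bezout-zero F G G≡0 = record
  { h = F ; A = const 1ℚ ; B = [] ; F₁ = const 1ℚ ; G₁ = []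
  ; factorF  = λ t → trans (sym (ℚP.*-identityʳ _)) (cong (eval F t *_) (sym (eval-const 1ℚ t)))
  ; factorG  = λ t → trans (G≡0 t) (sym (ℚP.*-zeroʳ (eval F t)))
  ; identity = λ t → cong₂ (λ u v → u * v + 0ℚ * 0ℚ) (eval-const 1ℚ t) (eval-const 1ℚ t) }

bezout-step : ∀ F G M R → (∀ t → eval F t ≡ eval M t * eval G t + eval R t) →
              Bezout R G → Bezout F G
bezout-step F G M R split c = record
  { h = h ; A = A ; B = B ⊖ A ⊗ M ; F₁ = M ⊗ G₁ ⊕ F₁ ; G₁ = G₁
  ; factorF = factorF′ ; factorG = factorG ; identity = identity′ }
  where
  open Bezout c
  open ℚ-Solver

  F₁′ : ∀ t → eval (M ⊗ G₁ ⊕ F₁) t ≡ eval M t * eval G₁ t + eval F₁ t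
  F₁′ t = trans (eval-⊕ (M ⊗ G₁) F₁ t) (cong (_+ eval F₁ t) (eval-⊗ M G₁ t))

  B′ : ∀ t → eval (B ⊖ A ⊗ M) t ≡ eval B t - eval A t * eval M t
  B′ t = trans (eval-⊖ B (A ⊗ M) t) (cong (λ u → eval B t - u) (eval-⊗ A M t))

  factorF′ : ∀ t → eval F t ≡ eval h t * eval (M ⊗ G₁ ⊕ F₁) t
  factorF′ t = begin
    eval F t                                                ≡⟨ split t ⟩
    eval M t * eval G t + eval R t                          ≡⟨ cong₂ (λ u v → eval M t * u + v) (factorG t) (Bezout.factorF c t) ⟩
    eval M t * (eval h t * eval G₁ t) + eval h t * eval F₁ t ≡⟨ solve 4 (λ m h g r → m :* (h :* g) :+ h :* r := h :* (m :* g :+ r)) refl (eval M t) (eval h t) (eval G₁ t) (eval F₁ t) ⟩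
    eval h t * (eval M t * eval G₁ t + eval F₁ t)           ≡⟨ cong (eval h t *_) (sym (F₁′ t)) ⟩
    eval h t * eval (M ⊗ G₁ ⊕ F₁) t                         ∎
    where open ≡-Reasoning

  identity′ : ∀ t → eval A t * eval (M ⊗ G₁ ⊕ F₁) t + eval (B ⊖ A ⊗ M) t * eval G₁ t ≡ 1ℚ
  identity′ t = begin
    eval A t * eval (M ⊗ G₁ ⊕ F₁) t + eval (B ⊖ A ⊗ M) t * eval G₁ t
      ≡⟨ cong₂ (λ u v → eval A t * u + v * eval G₁ t) (F₁′ t) (B′ t) ⟩
    eval A t * (eval M t * eval G₁ t + eval F₁ t) + (eval B t - eval A t * eval M t) * eval G₁ t
      ≡⟨ solve 5 (λ a m g f b → a :* (m :* g :+ f) :+ (b :- a :* m) :* g := a :* f :+ b :* g) refl (eval A t) (eval M t) (eval G₁ t) (eval F₁ t) (eval B t) ⟩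
    eval A t * eval F₁ t + eval B t * eval G₁ t
      ≡⟨ identity t ⟩
    1ℚ ∎
    where open ≡-Reasoning

euclid : ∀ n F G → length F ℕ.+ length G ℕ.< n → Bezout F G
euclid (suc n) F G bound with leadingTerm F | leadingTerm G
... | _ | vanishing G≡0 = bezout-zero F G G≡0
... | vanishing F≡0 | leading _ _ _ _ _ = bezout-swap (bezout-zero G F F≡0)
... | leading Fs a a≢0 eqF ltF | leading Gs b b≢0 eqG ltG with length Gs ℕP.≤? length Fs
...   | yes Gs≤Fs = bezout-step F G M R split (euclid n R G bound′)
  where
  open DivisionStep (cancelLeadingTerm F G Fs Gs a b b≢0 eqF eqG Gs≤Fs)
  bound′ : length R ℕ.+ length G ℕ.< n
  bound′ = ℕP.<-≤-trans (ℕP.+-monoˡ-< (length G) (ℕP.≤-<-trans short ltF)) (ℕP.≤-pred bound)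
...   | no Gs≰Fs = bezout-swap (bezout-step G F M R split (euclid n R F bound′))
  where
  open DivisionStep (cancelLeadingTerm G F Gs Fs b a a≢0 eqG eqF (ℕP.<⇒≤ (ℕP.≰⇒> Gs≰Fs)))
  bound′ : length R ℕ.+ length F ℕ.< n
  bound′ = ℕP.<-≤-trans (ℕP.+-monoˡ-< (length F) (ℕP.≤-<-trans short ltG))
                        (ℕP.≤-trans (ℕP.≤-reflexive (ℕP.+-comm (length G) (length F))) (ℕP.≤-pred bound))

-- Any two polynomials in ℚ[t] have a Bézout certificate.  Kept abstract:
-- later steps use only its specification, and unfolding the algorithm
-- would make type checking needlessly expensive.
abstract
  bezout : ∀ F G → Bezout F G
  bezout F G = euclid (suc (length F ℕ.+ length G)) F G ℕP.≤-refl

PolyZ : Set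
PolyZ = List ℤ

evalZ : PolyZ → ℤ → ℤ
evalZ []      x = + 0
evalZ (a ∷ P) x = a ℤ.+ x ℤ.* evalZ P x

embed : PolyZ → Poly
embed = map toℚ

eval-embed : ∀ P x → eval (embed P) (toℚ x) ≡ toℚ (evalZ P x)
eval-embed []      x = refl
eval-embed (a ∷ P) x = begin
  toℚ a + toℚ x * eval (embed P) (toℚ x)   ≡⟨ cong (λ u → toℚ a + toℚ x * u) (eval-embed P x) ⟩
  toℚ a + toℚ x * toℚ (evalZ P x)          ≡⟨ cong (λ u → toℚ a + u) (toℚ-* x (evalZ P x)) ⟨
  toℚ a + toℚ (x ℤ.* evalZ P x)            ≡⟨ toℚ-+ a (x ℤ.* evalZ P x) ⟨
  toℚ (a ℤ.+ x ℤ.* evalZ P x)              ∎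
  where open ≡-Reasoning

integralMultiple : ∀ K q → ↧ₙ q ℕD.∣ K → Σ ℤ λ z → toℚ z ≡ toℚ (+ K) * q
integralMultiple K q@record{} (ℕD.divides m refl) = + m ℤ.* ↥ q , (begin
  toℚ (+ m ℤ.* ↥ q)                   ≡⟨ toℚ-* (+ m) (↥ q) ⟩
  toℚ (+ m) * toℚ (↥ q)               ≡⟨ cong (toℚ (+ m) *_) (sym (ℚP.toℚᵘ-injective denominator-cancels)) ⟩
  toℚ (+ m) * (toℚ (+ ↧ₙ q) * q)      ≡⟨ ℚP.*-assoc (toℚ (+ m)) (toℚ (+ ↧ₙ q)) q ⟨
  toℚ (+ m) * toℚ (+ ↧ₙ q) * q        ≡⟨ cong (_* q) (toℚ-ℕ* m (↧ₙ q)) ⟨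
  toℚ (+ (m ℕ.* ↧ₙ q)) * q            ∎)
  where
  open ≡-Reasoning
  denominator-cancels : ℚ.toℚᵘ (toℚ (+ ↧ₙ q) * q) ℚᵘ.≃ ℚ.toℚᵘ (toℚ (↥ q))
  denominator-cancels = ℚᵘP.≃-trans (ℚP.toℚᵘ-homo-* (toℚ (+ ↧ₙ q)) q)
    (ℚᵘP.≃-trans (ℚᵘP.*-congʳ (toℚᵘ-toℚ (+ ↧ₙ q)))
      (ℚᵘP.≃-trans (ℚᵘ.*≡* (trans (ℤP.*-identityʳ _) (trans (ℤP.*-comm (+ ↧ₙ q) (↥ q)) (cong (λ z → ↥ q ℤ.* + z) (sym (ℕP.*-identityˡ (↧ₙ q)))))))
        (ℚᵘP.≃-sym (toℚᵘ-toℚ (↥ q)))))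

Cleared : ℕ → Poly → Set
Cleared K R = Σ PolyZ λ Z → ∀ x → toℚ (evalZ Z x) ≡ toℚ (+ K) * eval R (toℚ x)

clearDenominators : ∀ K R → (∀ {q} → q ∈ R → ↧ₙ q ℕD.∣ K) → Cleared K R
clearDenominators K []      dvd = [] , λ x → sym (ℚP.*-zeroʳ (toℚ (+ K)))
clearDenominators K (q ∷ R) dvd with integralMultiple K q (dvd (here refl)) | clearDenominators K R (dvd ∘′ there)
... | z , z≡Kq | Z , eqZ = z ∷ Z , λ x → begin
  toℚ (z ℤ.+ x ℤ.* evalZ Z x)              ≡⟨ toℚ-+ z (x ℤ.* evalZ Z x) ⟩
  toℚ z + toℚ (x ℤ.* evalZ Z x)            ≡⟨ cong (λ u → toℚ z + u) (toℚ-* x (evalZ Z x)) ⟩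
  toℚ z + toℚ x * toℚ (evalZ Z x)          ≡⟨ cong₂ (λ u v → u + toℚ x * v) z≡Kq (eqZ x) ⟩
  k * q + toℚ x * (k * eval R (toℚ x))     ≡⟨ solve 4 (λ k q t e → k :* q :+ t :* (k :* e) := k :* (q :+ t :* e)) refl k q (toℚ x) (eval R (toℚ x)) ⟩
  k * (q + toℚ x * eval R (toℚ x))         ∎
  where
  open ≡-Reasoning; open ℚ-Solver
  k = toℚ (+ K)

cleared-product : ∀ K {h E E₁} (hc : Cleared K h) (E₁c : Cleared K E₁) →
  (∀ t → eval E t ≡ eval h t * eval E₁ t) →
  ∀ x a → toℚ a ≡ eval E (toℚ x) → + (K ℕ.* K) ℤ.* a ≡ evalZ (proj₁ hc) x ℤ.* evalZ (proj₁ E₁c) x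
cleared-product K {h} {E₁ = E₁} (hℤ , eqh) (E₁ℤ , eqE₁) E≡hE₁ x a a≡E = toℚ-injective (begin
  toℚ (+ (K ℕ.* K) ℤ.* a)                         ≡⟨ toℚ-* (+ (K ℕ.* K)) a ⟩
  toℚ (+ (K ℕ.* K)) * toℚ a                       ≡⟨ cong₂ _*_ (toℚ-ℕ* K K) (trans a≡E (E≡hE₁ t)) ⟩
  k * k * (eval h t * eval E₁ t)                  ≡⟨ solve 3 (λ k a b → (k :* k) :* (a :* b) := (k :* a) :* (k :* b)) refl k (eval h t) (eval E₁ t) ⟩
  (k * eval h t) * (k * eval E₁ t)                ≡⟨ cong₂ _*_ (eqh x) (eqE₁ x) ⟨
  toℚ (evalZ hℤ x) * toℚ (evalZ E₁ℤ x)            ≡⟨ toℚ-* (evalZ hℤ x) (evalZ E₁ℤ x) ⟨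
  toℚ (evalZ hℤ x ℤ.* evalZ E₁ℤ x)                ∎)
  where
  open ≡-Reasoning; open ℚ-Solver
  k = toℚ (+ K)
  t = toℚ x

cleared-identity : ∀ K {A B F₁ G₁} (Ac : Cleared K A) (Bc : Cleared K B) (F₁c : Cleared K F₁) (G₁c : Cleared K G₁) →
  (∀ t → eval A t * eval F₁ t + eval B t * eval G₁ t ≡ 1ℚ) →
  ∀ x → evalZ (proj₁ Ac) x ℤ.* evalZ (proj₁ F₁c) x ℤ.+ evalZ (proj₁ Bc) x ℤ.* evalZ (proj₁ G₁c) x ≡ + (K ℕ.* K)
cleared-identity K {A} {B} {F₁} {G₁} (Aℤ , eqA) (Bℤ , eqB) (F₁ℤ , eqF₁) (G₁ℤ , eqG₁) identity x = toℚ-injective (begin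
  toℚ (a′ ℤ.* f′ ℤ.+ b′ ℤ.* g′)                    ≡⟨ toℚ-+ (a′ ℤ.* f′) (b′ ℤ.* g′) ⟩
  toℚ (a′ ℤ.* f′) + toℚ (b′ ℤ.* g′)                ≡⟨ cong₂ _+_ (toℚ-* a′ f′) (toℚ-* b′ g′) ⟩
  toℚ a′ * toℚ f′ + toℚ b′ * toℚ g′                ≡⟨ cong₂ _+_ (cong₂ _*_ (eqA x) (eqF₁ x)) (cong₂ _*_ (eqB x) (eqG₁ x)) ⟩
  (k * a) * (k * f) + (k * b) * (k * g)           ≡⟨ solve 5 (λ k a f b g → (k :* a) :* (k :* f) :+ (k :* b) :* (k :* g) := (k :* k) :* (a :* f :+ b :* g)) refl k a f b g ⟩
  k * k * (a * f + b * g)                         ≡⟨ cong (k * k *_) (identity t) ⟩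
  k * k * 1ℚ                                      ≡⟨ ℚP.*-identityʳ (k * k) ⟩
  k * k                                           ≡⟨ toℚ-ℕ* K K ⟨
  toℚ (+ (K ℕ.* K))                               ∎)
  where
  open ≡-Reasoning; open ℚ-Solver
  k = toℚ (+ K)
  t = toℚ x
  a′ = evalZ Aℤ x ; b′ = evalZ Bℤ x ; f′ = evalZ F₁ℤ x ; g′ = evalZ G₁ℤ x
  a = eval A t ; b = eval B t ; f = eval F₁ t ; g = eval G₁ t

commonDenominator : List ℚ → ℕ
commonDenominator qs = product (map ↧ₙ_ qs)

commonDenominator≢0 : ∀ qs → ℕ.NonZero (commonDenominator qs)
commonDenominator≢0 qs = product≢0 (AllP.map⁺ (All.universal (λ _ → ℕ.≢-nonZero (λ ())) qs))

denominator∣commonDenominator : ∀ {q qs} → q ∈ qs → ↧ₙ q ℕD.∣ commonDenominator qs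
denominator∣commonDenominator q∈qs = ∈⇒∣product (∈-map⁺ ↧ₙ_ q∈qs)

record IntegralBezout (F G : Poly) : Set where
  field
    c         : ℕ
    c≢0       : ℕ.NonZero c
    H P Q A B : PolyZ
    factorF   : ∀ x a → toℚ a ≡ eval F (toℚ x) → + c ℤ.* a ≡ evalZ H x ℤ.* evalZ P x
    factorG   : ∀ x b → toℚ b ≡ eval G (toℚ x) → + c ℤ.* b ≡ evalZ H x ℤ.* evalZ Q x
    identity  : ∀ x → evalZ A x ℤ.* evalZ P x ℤ.+ evalZ B x ℤ.* evalZ Q x ≡ + c

-- Multiply a rational Bézout certificate through by K² for a common
-- denominator K of all its coefficients.
integralBezout : ∀ F G → IntegralBezout F G
integralBezout F G = record
  { c = K ℕ.* K ; c≢0 = ℕP.m*n≢0 K K {{K≢0}} {{K≢0}}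
  ; H = proj₁ hc ; P = proj₁ F₁c ; Q = proj₁ G₁c ; A = proj₁ Ac ; B = proj₁ Bc
  ; factorF  = cleared-product K {h} {F} {F₁} hc F₁c factorF
  ; factorG  = cleared-product K {h} {G} {G₁} hc G₁c factorG
  ; identity = cleared-identity K {A} {B} {F₁} {G₁} Ac Bc F₁c G₁c identity }
  where
  open Bezout (bezout F G)

  coefficients : List ℚ
  coefficients = h ++ A ++ B ++ F₁ ++ G₁
  K : ℕ
  K = commonDenominator coefficients
  K≢0 : ℕ.NonZero K
  K≢0 = commonDenominator≢0 coefficients

  clear : ∀ R → (∀ {q} → q ∈ R → q ∈ coefficients) → Cleared K R
  clear R sub = clearDenominators K R (denominator∣commonDenominator ∘′ sub)

  hc : Cleared K h
  hc = clear h ∈-++⁺ˡ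
  Ac : Cleared K A
  Ac = clear A (∈-++⁺ʳ h ∘′ ∈-++⁺ˡ)
  Bc : Cleared K B
  Bc = clear B (∈-++⁺ʳ h ∘′ ∈-++⁺ʳ A ∘′ ∈-++⁺ˡ)
  F₁c : Cleared K F₁
  F₁c = clear F₁ (∈-++⁺ʳ h ∘′ ∈-++⁺ʳ A ∘′ ∈-++⁺ʳ B ∘′ ∈-++⁺ˡ)
  G₁c : Cleared K G₁
  G₁c = clear G₁ (∈-++⁺ʳ h ∘′ ∈-++⁺ʳ A ∘′ ∈-++⁺ʳ B ∘′ ∈-++⁺ʳ F₁)

gcd-commonFactor : ∀ c a b h p q → + c ℤ.* a ≡ h ℤ.* p → + c ℤ.* b ≡ h ℤ.* q →
                   c ℕ.* ℕG.gcd (∣ a ∣) (∣ b ∣) ≡ ∣ h ∣ ℕ.* ℕG.gcd (∣ p ∣) (∣ q ∣)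
gcd-commonFactor c a b h p q ca≡hp cb≡hq = begin
  c ℕ.* ℕG.gcd (∣ a ∣) (∣ b ∣)                      ≡⟨ ℕG.c*gcd[m,n]≡gcd[cm,cn] c (∣ a ∣) (∣ b ∣) ⟩
  ℕG.gcd (c ℕ.* ∣ a ∣) (c ℕ.* ∣ b ∣)            ≡⟨ cong₂ ℕG.gcd (absolute ca≡hp) (absolute cb≡hq) ⟩
  ℕG.gcd (∣ h ∣ ℕ.* ∣ p ∣) (∣ h ∣ ℕ.* ∣ q ∣)    ≡⟨ ℕG.c*gcd[m,n]≡gcd[cm,cn] (∣ h ∣) (∣ p ∣) (∣ q ∣) ⟨
  ∣ h ∣ ℕ.* ℕG.gcd (∣ p ∣) (∣ q ∣)                  ∎
  where
  open ≡-Reasoning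
  absolute : ∀ {a p} → + c ℤ.* a ≡ h ℤ.* p → c ℕ.* ∣ a ∣ ≡ ∣ h ∣ ℕ.* ∣ p ∣
  absolute {a} {p} eq = trans (sym (ℤP.abs-* (+ c) a)) (trans (cong ∣_∣ eq) (ℤP.abs-* h p))

gcdAt : PolyZ → PolyZ → ℤ → ℕ
gcdAt P Q x = ℕG.gcd (∣ evalZ P x ∣) (∣ evalZ Q x ∣)

evalZ-congruence : ∀ P C x y → C ∣ℤ (evalZ P (x ℤ.+ C ℤ.* y) ℤ.- evalZ P x)
evalZ-congruence []      C x y = divides (+ 0) refl
evalZ-congruence (a ∷ P) C x y = subst (C ∣ℤ_) regroup
  (∣m∣n⇒∣m+n (∣n⇒∣m*n x (evalZ-congruence P C x y)) (∣n⇒∣m*n y (∣n⇒∣m*n p′ ∣-refl)))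
  where
  open ℤ-Solver
  x′ = x ℤ.+ C ℤ.* y
  p′ = evalZ P x′
  p  = evalZ P x
  regroup : x ℤ.* (p′ ℤ.- p) ℤ.+ y ℤ.* (p′ ℤ.* C) ≡ (a ℤ.+ x′ ℤ.* p′) ℤ.- (a ℤ.+ x ℤ.* p)
  regroup = solve 6 (λ a x y C p′ p → x :* (p′ :- p) :+ y :* (p′ :* C) := (a :+ (x :+ C :* y) :* p′) :- (a :+ x :* p)) refl a x y C p′ p

-- If A·P + B·Q = C identically, then gcd(P(x), Q(x)) divides C and hence
-- divides gcd(P(x'), Q(x')) whenever x' ≡ x (mod C).
module _ (P Q A B : PolyZ) (C : ℤ) (identity : ∀ x → evalZ A x ℤ.* evalZ P x ℤ.+ evalZ B x ℤ.* evalZ Q x ≡ C) where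

  private
    g∣P : ∀ x → + gcdAt P Q x ∣ℤ evalZ P x
    g∣P x = ∣ᵤ⇒∣ (ℕG.gcd[m,n]∣m (∣ evalZ P x ∣) (∣ evalZ Q x ∣))

    g∣Q : ∀ x → + gcdAt P Q x ∣ℤ evalZ Q x
    g∣Q x = ∣ᵤ⇒∣ (ℕG.gcd[m,n]∣n (∣ evalZ P x ∣) (∣ evalZ Q x ∣))

    g∣C : ∀ x → + gcdAt P Q x ∣ℤ C
    g∣C x = subst (_ ∣ℤ_) (identity x) (∣m∣n⇒∣m+n (∣n⇒∣m*n (evalZ A x) (g∣P x)) (∣n⇒∣m*n (evalZ B x) (g∣Q x)))

    transport : ∀ {d} u u′ → d ∣ℤ C → d ∣ℤ u → C ∣ℤ (u′ ℤ.- u) → d ∣ℤ u′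
    transport {d} u u′ d∣C d∣u C∣diff = subst (d ∣ℤ_) (solve 2 (λ u u′ → u :+ (u′ :- u) := u′) refl u u′)
      (∣m∣n⇒∣m+n d∣u (∣-trans d∣C C∣diff))
      where open ℤ-Solver

  gcdAt-∣-shift : ∀ x y → gcdAt P Q x ℕD.∣ gcdAt P Q (x ℤ.+ C ℤ.* y)
  gcdAt-∣-shift x y = ℕG.gcd-greatest
    (∣⇒∣ᵤ (transport (evalZ P x) (evalZ P x′) (g∣C x) (g∣P x) (evalZ-congruence P C x y)))
    (∣⇒∣ᵤ (transport (evalZ Q x) (evalZ Q x′) (g∣C x) (g∣Q x) (evalZ-congruence Q C x y)))
    where x′ = x ℤ.+ C ℤ.* y

  gcdAt-periodic : ∀ x y → gcdAt P Q (x ℤ.+ C ℤ.* y) ≡ gcdAt P Q x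
  gcdAt-periodic x y = ℕD.∣-antisym (subst (λ z → gcdAt P Q x′ ℕD.∣ gcdAt P Q z) back (gcdAt-∣-shift x′ (ℤ.- y)))
                                    (gcdAt-∣-shift x y)
    where
    open ℤ-Solver
    x′ = x ℤ.+ C ℤ.* y
    back : x′ ℤ.+ C ℤ.* ℤ.- y ≡ x
    back = solve 3 (λ x C y → (x :+ C :* y) :+ C :* (:- y) := x) refl x C y

positive-shift : ∀ a m → ∣ a ∣ ℕ.< m → 0ℤ ℤ.< a ℤ.+ + m
positive-shift (+ j)    m |a|<m = ℤ.+<+ (ℕP.<-≤-trans (ℕP.m<n⇒0<n |a|<m) (ℕP.m≤n+m m j))
positive-shift -[1+ j ] m |a|<m = subst (0ℤ ℤ.<_) (sym (ℤP.⊖-≥ (ℕP.<⇒≤ |a|<m))) (ℤ.+<+ (ℕP.m<n⇒0<n∸m |a|<m))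

-- The inductive step for signs of values: if σ·q > 0 and n > |a| then
-- σ·(a + n·q) > 0, since the term n·σq outweighs σ·a.
positive-step : ∀ σ a q n → ∣ σ ∣ ≡ 1 → 0ℤ ℤ.< σ ℤ.* q → ∣ a ∣ ℕ.< n →
                0ℤ ℤ.< σ ℤ.* (a ℤ.+ + n ℤ.* q)
positive-step σ a q n ∣σ∣≡1 σq>0 |a|<n with σ ℤ.* q in σq≡k | σq>0
... | + k | ℤ.+<+ k>0 = subst (0ℤ ℤ.<_) regroup (positive-shift (σ ℤ.* a) (n ℕ.* k) bound)
  where
  instance _ = ℕ.>-nonZero k>0
  bound : ∣ σ ℤ.* a ∣ ℕ.< n ℕ.* k
  bound = subst (ℕ._< n ℕ.* k) (sym (trans (ℤP.abs-* σ a) (trans (cong (ℕ._* ∣ a ∣) ∣σ∣≡1) (ℕP.*-identityˡ ∣ a ∣))))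
                (ℕP.m<n⇒m<n*o k |a|<n)
  regroup : σ ℤ.* a ℤ.+ + (n ℕ.* k) ≡ σ ℤ.* (a ℤ.+ + n ℤ.* q)
  regroup = begin
    σ ℤ.* a ℤ.+ + (n ℕ.* k)         ≡⟨ cong (λ v → σ ℤ.* a ℤ.+ v) (trans (ℤP.pos-* n k) (cong (+ n ℤ.*_) (sym σq≡k))) ⟩
    σ ℤ.* a ℤ.+ + n ℤ.* (σ ℤ.* q)   ≡⟨ solve 4 (λ σ a n q → σ :* a :+ n :* (σ :* q) := σ :* (a :+ n :* q)) refl σ a (+ n) q ⟩
    σ ℤ.* (a ℤ.+ + n ℤ.* q)         ∎
    where open ≡-Reasoning; open ℤ-Solver

data EventualSign (P : PolyZ) (N : ℕ) : Set where
  vanishes : (∀ n → N ℕ.≤ n → evalZ P (+ n) ≡ 0ℤ) → EventualSign P N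
  signed   : ∀ σ → ∣ σ ∣ ≡ 1 → (∀ n → N ℕ.≤ n → 0ℤ ℤ.< σ ℤ.* evalZ P (+ n)) → EventualSign P N

signOf : ∀ a → a ≡ 0ℤ ⊎ Σ ℤ λ σ → ∣ σ ∣ ≡ 1 × 0ℤ ℤ.< σ ℤ.* a
signOf (+ zero)  = inj₁ refl
signOf +[1+ k ]  = inj₂ (+ 1 , refl , ℤ.+<+ (s≤s z≤n))
signOf -[1+ k ]  = inj₂ (-1ℤ , refl , ℤ.+<+ (s≤s z≤n))

eventualSign : ∀ P → Σ ℕ (EventualSign P)
eventualSign []      = 0 , vanishes (λ n _ → refl)
eventualSign (a ∷ Q) with eventualSign Q
... | N , vanishes Q≡0 = N , constantSign (signOf a)
  where
  value≡a : ∀ n → N ℕ.≤ n → evalZ (a ∷ Q) (+ n) ≡ a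
  value≡a n N≤n = trans (cong (λ v → a ℤ.+ + n ℤ.* v) (Q≡0 n N≤n)) (trans (cong (λ v → a ℤ.+ v) (ℤP.*-zeroʳ (+ n))) (ℤP.+-identityʳ a))

  constantSign : (a ≡ 0ℤ ⊎ Σ ℤ λ σ → ∣ σ ∣ ≡ 1 × 0ℤ ℤ.< σ ℤ.* a) → EventualSign (a ∷ Q) N
  constantSign (inj₁ a≡0)                = vanishes λ n N≤n → trans (value≡a n N≤n) a≡0
  constantSign (inj₂ (σ , ∣σ∣≡1 , σa>0)) = signed σ ∣σ∣≡1 λ n N≤n → subst (λ v → 0ℤ ℤ.< σ ℤ.* v) (sym (value≡a n N≤n)) σa>0
eventualSign (a ∷ Q) | N , signed σ ∣σ∣≡1 σQ>0 = N ℕ.⊔ suc ∣ a ∣ , signed σ ∣σ∣≡1 λ n le →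
  positive-step σ a (evalZ Q (+ n)) n ∣σ∣≡1 (σQ>0 n (ℕP.m⊔n≤o⇒m≤o N _ le)) (ℕP.m⊔n≤o⇒n≤o N _ le)

eventualAbs : ∀ P → Σ ℕ λ N → Σ ℤ λ σ → ∀ n → N ℕ.≤ n → + ∣ evalZ P (+ n) ∣ ≡ σ ℤ.* evalZ P (+ n)
eventualAbs P with eventualSign P
... | N , vanishes P≡0 = N , 0ℤ , λ n N≤n →
  trans (cong (λ v → + ∣ v ∣) (P≡0 n N≤n)) (sym (ℤP.*-zeroˡ (evalZ P (+ n))))
... | N , signed σ ∣σ∣≡1 σP>0 = N , σ , λ n N≤n → begin
  + ∣ evalZ P (+ n) ∣              ≡⟨ cong +_ (trans (sym (ℕP.*-identityˡ _)) (cong (ℕ._* ∣ evalZ P (+ n) ∣) (sym ∣σ∣≡1))) ⟩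
  + (∣ σ ∣ ℕ.* ∣ evalZ P (+ n) ∣)  ≡⟨ cong +_ (ℤP.abs-* σ (evalZ P (+ n))) ⟨
  + ∣ σ ℤ.* evalZ P (+ n) ∣        ≡⟨ ℤP.0≤i⇒+∣i∣≡i (ℤP.<⇒≤ (σP>0 n N≤n)) ⟩
  σ ℤ.* evalZ P (+ n)              ∎
  where open ≡-Reasoning

record QuasiPolynomial : Set where
  field
    period    : ℕ
    period≢0  : ℕ.NonZero period
    component : ℕ → Poly

open QuasiPolynomial

residue : QuasiPolynomial → ℕ → ℕ
residue q n = ℕ._%_ n (period q) {{period≢0 q}}

_⟨_⟩ : QuasiPolynomial → ℕ → ℚ
q ⟨ n ⟩ = eval (component q (residue q n)) (toℚ (+ n))

residue-∣ : ∀ q s .{{_ : ℕ.NonZero s}} {n i} → period q ℕD.∣ s → ℕ._%_ n s ≡ i → residue q n ≡ residue q i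
residue-∣ q s {n} p∣s refl = sym (m∣n⇒o%n%m≡o%m (period q) s n {{period≢0 q}} p∣s)

-- f agrees with a quasi-polynomial for all large arguments; this is
-- IsEventuallyQP with components indexed by ℕ instead of Fin.
EventuallyQP : (ℕ → ℤ) → Set
EventuallyQP f = Σ QuasiPolynomial λ q → Σ ℕ λ N → ∀ n → N ℕ.≤ n → toℚ (f n) ≡ q ⟨ n ⟩

toEventuallyQP : ∀ {f} → IsEventuallyQP f → EventuallyQP f
toEventuallyQP (k , fs , N , fits) = q , N , λ n N≤n → trans (fits n N≤n) (cong (λ i → eval (fs i) (toℚ (+ n))) (same-residue n))
  where
  q : QuasiPolynomial
  q = record { period = suc k ; period≢0 = _ ; component = λ r → fs (r mod suc k) }
  same-residue : ∀ n → n mod suc k ≡ (n ℕ.% suc k) mod suc k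
  same-residue n = FinP.toℕ-injective (trans (FinP.toℕ-fromℕ< (m%n<n n (suc k)))
    (trans (sym (m%n%n≡m%n n (suc k))) (sym (FinP.toℕ-fromℕ< (m%n<n (n ℕ.% suc k) (suc k))))))


fromEventuallyQP : ∀ {f} → EventuallyQP f → IsEventuallyQP f
fromEventuallyQP (record { period = suc k ; component = comp } , N , fits) =
  k , (λ i → comp (toℕ i)) , N , λ n N≤n → trans (fits n N≤n)
    (cong (λ i → eval (comp i) (toℚ (+ n))) (sym (FinP.toℕ-fromℕ< (m%n<n n (suc k)))))

solveForGcd : ∀ c G e h σ .{{_ : ℕ.NonZero c}} → c ℕ.* G ≡ ∣ h ∣ ℕ.* e → + ∣ h ∣ ≡ σ ℤ.* h →
              toℚ (+ G) ≡ (ℚ.1/ toℚ (+ c)) {{toℚ-nonZero c}} * toℚ (σ ℤ.* + e) * toℚ h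
solveForGcd c G e h σ cG≡he ∣h∣≡σh = begin
  toℚ (+ G)                                   ≡⟨ ℚP.*-identityˡ (toℚ (+ G)) ⟨
  1ℚ * toℚ (+ G)                              ≡⟨ cong (_* toℚ (+ G)) (ℚP.*-inverseˡ k {{toℚ-nonZero c}}) ⟨
  k⁻¹ * k * toℚ (+ G)                         ≡⟨ ℚP.*-assoc k⁻¹ k (toℚ (+ G)) ⟩
  k⁻¹ * (k * toℚ (+ G))                       ≡⟨ cong (k⁻¹ *_) kG≡σhe ⟩
  k⁻¹ * (toℚ σ * toℚ h * toℚ (+ e))           ≡⟨ solve 4 (λ i s h e → i :* (s :* h :* e) := i :* (s :* e) :* h) refl k⁻¹ (toℚ σ) (toℚ h) (toℚ (+ e)) ⟩
  k⁻¹ * (toℚ σ * toℚ (+ e)) * toℚ h           ≡⟨ cong (λ u → k⁻¹ * u * toℚ h) (toℚ-* σ (+ e)) ⟨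
  k⁻¹ * toℚ (σ ℤ.* + e) * toℚ h               ∎
  where
  open ≡-Reasoning; open ℚ-Solver
  k k⁻¹ : ℚ
  k = toℚ (+ c)
  k⁻¹ = (ℚ.1/ k) {{toℚ-nonZero c}}
  kG≡σhe : k * toℚ (+ G) ≡ toℚ σ * toℚ h * toℚ (+ e)
  kG≡σhe = begin
    k * toℚ (+ G)               ≡⟨ toℚ-ℕ* c G ⟨
    toℚ (+ (c ℕ.* G))           ≡⟨ cong (λ m → toℚ (+ m)) cG≡he ⟩
    toℚ (+ (∣ h ∣ ℕ.* e))       ≡⟨ toℚ-ℕ* ∣ h ∣ e ⟩
    toℚ (+ ∣ h ∣) * toℚ (+ e)   ≡⟨ cong (λ u → toℚ u * toℚ (+ e)) ∣h∣≡σh ⟩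
    toℚ (σ ℤ.* h) * toℚ (+ e)   ≡⟨ cong (_* toℚ (+ e)) (toℚ-* σ h) ⟩
    toℚ σ * toℚ h * toℚ (+ e)   ∎

divMod-ℤ : ∀ n c .{{_ : ℕ.NonZero c}} → + n ≡ + (n ℕ.% c) ℤ.+ + c ℤ.* + (n ℕ./ c)
divMod-ℤ n c = begin
  + n                                   ≡⟨ cong +_ (m≡m%n+[m/n]*n n c) ⟩
  + (n ℕ.% c ℕ.+ n ℕ./ c ℕ.* c)         ≡⟨ cong (λ m → + (n ℕ.% c ℕ.+ m)) (ℕP.*-comm (n ℕ./ c) c) ⟩
  + (n ℕ.% c ℕ.+ c ℕ.* (n ℕ./ c))       ≡⟨ ℤP.pos-+ (n ℕ.% c) (c ℕ.* (n ℕ./ c)) ⟩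
  + (n ℕ.% c) ℤ.+ + (c ℕ.* (n ℕ./ c))   ≡⟨ cong (λ v → + (n ℕ.% c) ℤ.+ v) (ℤP.pos-* c (n ℕ./ c)) ⟩
  + (n ℕ.% c) ℤ.+ + c ℤ.* + (n ℕ./ c)   ∎
  where open ≡-Reasoning

GcdQP : Poly → Poly → Set
GcdQP F G = Σ QuasiPolynomial λ q → Σ ℕ λ N → ∀ n → N ℕ.≤ n → ∀ a b →
  toℚ a ≡ eval F (toℚ (+ n)) → toℚ b ≡ eval G (toℚ (+ n)) → toℚ (gcd a b) ≡ q ⟨ n ⟩

-- With c·F = H·P, c·G = H·Q and A·P + B·Q = c over ℤ[t], we get
-- c·gcd(F(n), G(n)) = |H(n)|·gcd(P(n), Q(n)), where the second factor is
-- c-periodic and |H(n)| = σ·H(n) eventually.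
gcdOfValues : ∀ F G → GcdQP F G
gcdOfValues F G = q , N , agree
  where
  open IntegralBezout (integralBezout F G)
  instance _ = c≢0

  N : ℕ
  N = proj₁ (eventualAbs H)
  σ : ℤ
  σ = proj₁ (proj₂ (eventualAbs H))

  k⁻¹ : ℚ
  k⁻¹ = (ℚ.1/ toℚ (+ c)) {{toℚ-nonZero c}}

  -- the factor σ·gcd(P(r), Q(r))/c multiplying H on the class of r
  coefficient : ℕ → ℚ
  coefficient r = k⁻¹ * toℚ (σ ℤ.* + gcdAt P Q (+ r))

  q : QuasiPolynomial
  q = record { period = c ; period≢0 = c≢0 ; component = λ r → scale (coefficient r) (embed H) }

  agree : ∀ n → N ℕ.≤ n → ∀ a b → toℚ a ≡ eval F (toℚ (+ n)) → toℚ b ≡ eval G (toℚ (+ n)) → toℚ (gcd a b) ≡ q ⟨ n ⟩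
  agree n N≤n a b a≡F b≡G = begin
    toℚ (gcd a b)                                  ≡⟨ solveForGcd c _ _ (evalZ H (+ n)) σ
                                                        (gcd-commonFactor c a b (evalZ H (+ n)) (evalZ P (+ n)) (evalZ Q (+ n)) (factorF (+ n) a a≡F) (factorG (+ n) b b≡G))
                                                        (proj₂ (proj₂ (eventualAbs H)) n N≤n) ⟩
    k⁻¹ * toℚ (σ ℤ.* + gcdAt P Q (+ n)) * toℚ (evalZ H (+ n))
      ≡⟨ cong (λ e → k⁻¹ * toℚ (σ ℤ.* + e) * toℚ (evalZ H (+ n))) periodic ⟩
    coefficient r * toℚ (evalZ H (+ n))            ≡⟨ cong (coefficient r *_) (eval-embed H (+ n)) ⟨
    coefficient r * eval (embed H) (toℚ (+ n))     ≡⟨ eval-scale (coefficient r) (embed H) (toℚ (+ n)) ⟨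
    q ⟨ n ⟩                                        ∎
    where
    open ≡-Reasoning
    r = n ℕ.% c
    periodic : gcdAt P Q (+ n) ≡ gcdAt P Q (+ r)
    periodic = trans (cong (gcdAt P Q) (divMod-ℤ n c)) (gcdAt-periodic P Q A B (+ c) identity (+ r) (+ (n ℕ./ c)))

ClassQP : (ℕ → ℤ) → (s : ℕ) .{{_ : ℕ.NonZero s}} → ℕ → Set
ClassQP f s i = Σ QuasiPolynomial λ q → Σ ℕ λ N → ∀ n → N ℕ.≤ n → ℕ._%_ n s ≡ i → toℚ (f n) ≡ q ⟨ n ⟩

-- The glued period is s times the product of the periods of the classes
-- 0, …, s−1, and the threshold is the largest of theirs.
glue : ∀ f s .{{_ : ℕ.NonZero s}} → (∀ i → ClassQP f s i) → EventuallyQP f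
glue f s onClass = glued , M , agree
  where
  q : ℕ → QuasiPolynomial
  q i = proj₁ (onClass i)

  N : ℕ → ℕ
  N i = proj₁ (proj₂ (onClass i))

  classes : List ℕ
  classes = upTo s
  Π : ℕ
  Π = product (map (period ∘ q) classes)
  M : ℕ
  M = max 0 (map N classes)

  instance
    Π≢0 : ℕ.NonZero Π
    Π≢0 = product≢0 (AllP.map⁺ (All.universal (period≢0 ∘ q) classes))
    sΠ≢0 : ℕ.NonZero (s ℕ.* Π)
    sΠ≢0 = ℕP.m*n≢0 s Π

  glued : QuasiPolynomial
  glued = record { period = s ℕ.* Π ; period≢0 = sΠ≢0
                 ; component = λ r → component (q (r ℕ.% s)) (residue (q (r ℕ.% s)) r) }

  agree : ∀ n → M ℕ.≤ n → toℚ (f n) ≡ glued ⟨ n ⟩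
  agree n M≤n = begin
    toℚ (f n)                                          ≡⟨ proj₂ (proj₂ (onClass i)) n (ℕP.≤-trans Nᵢ≤M M≤n) refl ⟩
    eval (component (q i) (residue (q i) n)) t         ≡⟨ cong (λ m → eval (component (q i) m) t) (residue-∣ (q i) (s ℕ.* Π) pᵢ∣sΠ refl) ⟩
    eval (component (q i) (residue (q i) r)) t         ≡⟨ cong (λ j → eval (component (q j) (residue (q j) r)) t) r%s≡i ⟨
    glued ⟨ n ⟩                                        ∎
    where
    open ≡-Reasoning
    t = toℚ (+ n)
    i = n ℕ.% s
    r = n ℕ.% (s ℕ.* Π)
    i∈classes : i ∈ classes
    i∈classes = ∈-upTo⁺ (m%n<n n s)
    Nᵢ≤M : N i ℕ.≤ M
    Nᵢ≤M = All.lookup (xs≤max 0 (map N classes)) (∈-map⁺ N i∈classes)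
    pᵢ∣sΠ : period (q i) ℕD.∣ s ℕ.* Π
    pᵢ∣sΠ = ℕD.∣-trans (∈⇒∣product (∈-map⁺ (period ∘ q) i∈classes)) (ℕD.n∣m*n s)
    r%s≡i : r ℕ.% s ≡ i
    r%s≡i = m∣n⇒o%n%m≡o%m s (s ℕ.* Π) n (ℕD.m∣m*n Π)

-- Generalized gcds of eventual quasi-polynomials are eventual
-- quasi-polynomials: on the class of i modulo the product s of the two
-- periods, f and g are given by fixed polynomials, so gcdOfValues applies.
ggcd-eventuallyQP : ∀ f g → EventuallyQP f → EventuallyQP g → EventuallyQP (ggcd f g)
ggcd-eventuallyQP f g (qf , Nf , fits-f) (qg , Ng , fits-g) = glue (ggcd f g) s onClass
  where
  instance
    pf≢0 : ℕ.NonZero (period qf)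
    pf≢0 = period≢0 qf
    pg≢0 : ℕ.NonZero (period qg)
    pg≢0 = period≢0 qg
  s : ℕ
  s = period qf ℕ.* period qg
  instance
    s≢0 : ℕ.NonZero s
    s≢0 = ℕP.m*n≢0 (period qf) (period qg)

  onClass : ∀ i → ClassQP (ggcd f g) s i
  onClass i = restrict (gcdOfValues (component qf (residue qf i)) (component qg (residue qg i)))
    where
    restrict : GcdQP (component qf (residue qf i)) (component qg (residue qg i)) → ClassQP (ggcd f g) s i
    restrict (q , N , gcd≡) = q , N ℕ.⊔ (Nf ℕ.⊔ Ng) , λ n le n%s≡i →
      gcd≡ n (ℕP.m⊔n≤o⇒m≤o N _ le) (f n) (g n)
        (trans (fits-f n (ℕP.≤-trans (ℕP.m≤m⊔n Nf Ng) (ℕP.m⊔n≤o⇒n≤o N _ le)))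
               (cong (λ m → eval (component qf m) (toℚ (+ n))) (residue-∣ qf s (ℕD.m∣m*n (period qg)) n%s≡i)))
        (trans (fits-g n (ℕP.≤-trans (ℕP.m≤n⊔m Nf Ng) (ℕP.m⊔n≤o⇒n≤o N _ le)))
               (cong (λ m → eval (component qg m) (toℚ (+ n))) (residue-∣ qg s (ℕD.n∣m*n (period qf)) n%s≡i)))

theorem4p3 : (f g : ℕ → ℤ) → IsEventuallyQP f → IsEventuallyQP g → IsEventuallyQP (ggcd f g)
theorem4p3 f g qf qg = fromEventuallyQP {ggcd f g} (ggcd-eventuallyQP f g (toEventuallyQP {f} qf) (toEventuallyQP {g} qg))
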